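{- Let $G$ be a finite, simple, connected hamiltonian graph on at least $3$ vertices with maximum degree $\Delta(G)\leq 3$. Then the line graph $L(G)$ has the PMH--property, i.e. every perfect matching of $L(G)$ is contained in some hamiltonian cycle of $L(G)$.
   Context: The line graph $L(G)$ has vertex set $E(G)$, two vertices being adjacent when the corresponding edges of $G$ share an end-vertex. A graph has the Perfect--Matching--Hamiltonian property (PMH--property) if each of its perfect matchings can be extended to (i.e. is a subset of the edge set of) a hamiltonian cycle of the graph. -}

module Defs where

open import Data.Nat using (ℕ; zero; suc; _≤_; _<_)
open import Data.Fin using (Fin; toℕ) renaming (zero to fzero; suc to fsuc)
import Data.Fin as F
open import Data.Bool using (Bool; true; false)
open import Data.List using (List; length; filterᵇ; allFin)
open import Data.Product using (Σ; _×_; _,_; ∃; proj₁; proj₂)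
open import Data.Sum using (_⊎_)
open import Relation.Binary.PropositionalEquality using (_≡_)
open import Relation.Nullary using (¬_)
open import Level using (Level; suc; _⊔_) renaming (zero to lzero)

record Graph (V : Set) : Set₁ where
  field
    Adj    : V → V → Set
    sym    : ∀ {u v} → Adj u v → Adj v u
    irrefl : ∀ {v} → ¬ Adj v v
open Graph public

-- The modular successor on Fin k (k ≥ 1): i ↦ i+1 mod k.
nextFin : ∀ {k} → Fin (ℕ.suc k) → Fin (ℕ.suc k)
nextFin {zero}  fzero    = fzero
nextFin {suc k} fzero    = fsuc fzero
nextFin {suc k} (fsuc i) with nextFin {k} i
... | fzero   = fzero
... | fsuc j  = fsuc (fsuc j)

record HamCycle {V : Set} (G : Graph V) : Set where
  field
    len     : ℕ              -- the cycle has (suc len) vertices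
    len≥2   : 2 ≤ len
    vtx     : Fin (ℕ.suc len) → V
    inj     : ∀ i j → vtx i ≡ vtx j → i ≡ j
    surj    : ∀ v → ∃ λ i → vtx i ≡ v
    adj     : ∀ i → Adj G (vtx i) (vtx (nextFin i))
open HamCycle public

EdgeOfCycle : ∀ {V} {G : Graph V} → HamCycle G → V → V → Set
EdgeOfCycle C u v =
  Σ (Fin (ℕ.suc (len C))) λ i →
    (vtx C i ≡ u × vtx C (nextFin i) ≡ v) ⊎ (vtx C i ≡ v × vtx C (nextFin i) ≡ u)

Hamiltonian : ∀ {V} → Graph V → Set
Hamiltonian G = HamCycle G

record PerfectMatching {V : Set} (G : Graph V) : Set₁ where
  field
    M      : V → V → Set
    M-sym  : ∀ {u v} → M u v → M v u
    M⊆E    : ∀ {u v} → M u v → Adj G u v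
    unique : ∀ v → Σ V λ w → M v w × (∀ w' → M v w' → w' ≡ w)
open PerfectMatching public

PMH : ∀ {V} → Graph V → Set₁
PMH G = (PM : PerfectMatching G) →
  Σ (HamCycle G) λ C → ∀ u v → M PM u v → EdgeOfCycle C u v

record FinGraph (n : ℕ) : Set where
  field
    adjᵇ    : Fin n → Fin n → Bool
    symᵇ    : ∀ u v → adjᵇ u v ≡ adjᵇ v u
    irreflᵇ : ∀ v → adjᵇ v v ≡ false
open FinGraph public

toGraph : ∀ {n} → FinGraph n → Graph (Fin n)
toGraph {n} G = record
  { Adj = λ u v → adjᵇ G u v ≡ true
  ; sym = λ {u} {v} p → Relation.Binary.PropositionalEquality.trans (symᵇ G v u) p
  ; irrefl = λ {v} p → bad (Relation.Binary.PropositionalEquality.trans (Relation.Binary.PropositionalEquality.sym (irreflᵇ G v)) p)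
  }
  where
  open import Data.Empty using (⊥)
  bad : false ≡ true → ⊥
  bad ()

degree : ∀ {n} → FinGraph n → Fin n → ℕ
degree G v = length (filterᵇ (adjᵇ G v) (allFin _))

MaxDegreeAtMost : ∀ {n} → FinGraph n → ℕ → Set
MaxDegreeAtMost G d = ∀ v → degree G v ≤ d

data Reachable {V : Set} (G : Graph V) : V → V → Set where
  here : ∀ {v} → Reachable G v v
  step : ∀ {u v w} → Adj G u v → Reachable G v w → Reachable G u w

Connected : ∀ {V} → Graph V → Set
Connected G = ∀ u v → Reachable G u v

Edge : ∀ {n} → FinGraph n → Set
Edge G = Σ (Fin _ × Fin _) λ p →
  (proj₁ p F.< proj₂ p) × (adjᵇ G (proj₁ p) (proj₂ p) ≡ true)

ShareEnd : ∀ {n} {G : FinGraph n} → Edge G → Edge G → Set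
ShareEnd ((a , b) , _) ((c , d) , _) = (a ≡ c) ⊎ (a ≡ d) ⊎ (b ≡ c) ⊎ (b ≡ d)

LineGraph : ∀ {n} (G : FinGraph n) → Graph (Edge G)
LineGraph G = record
  { Adj = λ e f → ¬ (e ≡ f) × ShareEnd {G = G} e f
  ; sym = λ { {e} {f} (ne , s) → (λ eq → ne (≡sym eq)) , symS {e} {f} s }
  ; irrefl = λ { (ne , _) → ne Relation.Binary.PropositionalEquality.refl }
  }
  where
  open import Relation.Binary.PropositionalEquality renaming (sym to ≡sym) using ()
  open import Data.Sum using (inj₁; inj₂)
  symS : ∀ {e f} → ShareEnd {G = G} e f → ShareEnd {G = G} f e
  symS (inj₁ p) = inj₁ (≡sym p)
  symS (inj₂ (inj₁ p)) = inj₂ (inj₂ (inj₁ (≡sym p)))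
  symS (inj₂ (inj₂ (inj₁ p))) = inj₂ (inj₁ (≡sym p))
  symS (inj₂ (inj₂ (inj₂ p))) = inj₂ (inj₂ (inj₂ (≡sym p)))

module Submission where

-- Let v₀ v₁ … v_k be a hamiltonian cycle of G and eᵢ = vᵢvᵢ₊₁ its edges
-- (indices mod k+1). As Δ(G) ≤ 3, the vertex vᵢ₊₁ meets eᵢ, eᵢ₊₁ and at most
-- one further edge, a chord. Fix a perfect matching M of L(G). The M-partner
-- of a chord h shares an end with h; it is not a chord (two chords never
-- meet), so it is eᵢ or eᵢ₊₁ for exactly one end vᵢ₊₁ of h: we say that h is
-- attached at i. The required hamiltonian cycle of L(G) is
--     e₀ [h₀] e₁ [h₁] … e_k [h_k] (back to e₀),
-- where hᵢ is the chord attached at i, if there is one. Every edge of G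
-- occurs exactly once, consecutive entries share the vertex vᵢ₊₁, and every
-- M-edge joins consecutive entries: a chord stands next to its partner, and
-- M-matched cycle edges eᵢ, eᵢ₊₁ have no chord between them (it would be
-- matched to one of them as well).

open import Defs hiding (sym)
open import Data.Nat as ℕ using (ℕ; _≤_; s≤s; z≤n)
import Data.Nat.Properties as ℕP
open import Data.Fin using (Fin; toℕ; fromℕ; inject₁) renaming (zero to fzero; suc to fsuc)
import Data.Fin.Properties as FinP
open import Data.Bool using (true)
import Data.Bool as Bool
open import Data.Maybe using (Maybe; just; nothing)
open import Data.List using (List; []; _∷_; _++_; [_]; length; lookup; allFin; tabulate; concatMap; fromMaybe; filterᵇ; drop)
import Data.List.Properties as ListP
open import Data.List.Relation.Unary.Linked using (Linked; []; [-]; _∷_)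
open import Data.List.Relation.Unary.All as All using (All; []; _∷_)
open import Data.List.Relation.Unary.AllPairs using ([]; _∷_)
open import Data.List.Relation.Unary.Unique.Propositional using (Unique)
import Data.List.Relation.Unary.Unique.Propositional.Properties as UniqueP
open import Data.List.Relation.Unary.Any using (here; there; index)
open import Data.List.Relation.Unary.Any.Properties using (lookup-index)
open import Data.List.Membership.Propositional using (_∈_)
open import Data.List.Membership.Propositional.Properties using (∈-allFin; ∈-lookup; ∈-++⁻; ∈-++⁺ˡ; ∈-++⁺ʳ; ∈-filter⁺)
open import Data.Product using (Σ; _×_; _,_; ∃; proj₁; proj₂)
open import Data.Sum using (_⊎_; inj₁; inj₂)
open import Data.Empty using (⊥-elim)
open import Relation.Nullary using (¬_; Dec; yes; no)
open import Relation.Nullary.Decidable using (_×-dec_; _⊎-dec_; ¬?)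
open import Relation.Binary.Definitions using (tri<; tri≈; tri>)
open import Relation.Binary.PropositionalEquality using (_≡_; _≢_; refl; sym; trans; cong; cong₂; subst; module ≡-Reasoning)
open import Axiom.UniquenessOfIdentityProofs using (module Decidable⇒UIP)

-- Hamiltonian cycles from closed walks written as lists.

module ClosedWalk {V : Set} (Γ : Graph V) where

  data Consecutive (u v : V) : List V → Set where
    here  : ∀ {ys} → Consecutive u v (u ∷ v ∷ ys)
    there : ∀ {y ys} → Consecutive u v ys → Consecutive u v (y ∷ ys)

  consecutive-++ʳ : ∀ {u v} xs {ys} → Consecutive u v ys → Consecutive u v (xs ++ ys)
  consecutive-++ʳ []       p = p
  consecutive-++ʳ (x ∷ xs) p = there (consecutive-++ʳ xs p)

  consecutive-++ˡ : ∀ {u v} xs {y ys} → Consecutive u v (xs ++ [ y ]) → Consecutive u v (xs ++ y ∷ ys)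
  consecutive-++ˡ []            (there ())
  consecutive-++ˡ (x ∷ [])      here               = here
  consecutive-++ˡ (x ∷ [])      (there (there ()))
  consecutive-++ˡ (x ∷ x′ ∷ xs) here               = here
  consecutive-++ˡ (x ∷ x′ ∷ xs) (there p)          = there (consecutive-++ˡ (x′ ∷ xs) p)

  linked-consecutive : ∀ {u v ys} → Linked (Adj Γ) ys → Consecutive u v ys → Adj Γ u v
  linked-consecutive (r ∷ _) here      = r
  linked-consecutive (_ ∷ l) (there p) = linked-consecutive l p
  linked-consecutive [-]     (there ())

  linked-join : ∀ xs {y ys} → Linked (Adj Γ) (xs ++ [ y ]) → Linked (Adj Γ) (y ∷ ys) →
    Linked (Adj Γ) (xs ++ y ∷ ys)
  linked-join []            _         l = l
  linked-join (x ∷ [])      (r ∷ [-]) l = r ∷ l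
  linked-join (x ∷ x′ ∷ xs) (r ∷ l₁)  l = r ∷ linked-join (x′ ∷ xs) l₁ l

  lookup-injective : ∀ {xs : List V} → Unique xs → ∀ i j → lookup xs i ≡ lookup xs j → i ≡ j
  lookup-injective (_  ∷ _) fzero    fzero    _ = refl
  lookup-injective (x∉ ∷ _) fzero    (fsuc j) e = ⊥-elim (All.lookup x∉ (∈-lookup j) e)
  lookup-injective (x∉ ∷ _) (fsuc i) fzero    e = ⊥-elim (All.lookup x∉ (∈-lookup i) (sym e))
  lookup-injective (_ ∷ u)  (fsuc i) (fsuc j) e = cong fsuc (lookup-injective u i j e)

  -- Position arithmetic in the closed walk y ∷ ys ++ [ z ]: the entry after
  -- position i is found at position nextFin i of z ∷ ys (the last entry of
  -- y ∷ ys is followed by the closing entry z).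
  lookup-next-suc : ∀ (z y : V) ys (i : Fin (ℕ.suc (length ys))) →
    lookup (z ∷ y ∷ ys) (nextFin (fsuc i)) ≡ lookup (z ∷ ys) (nextFin i)
  lookup-next-suc z y ys i with nextFin i
  ... | fzero  = refl
  ... | fsuc _ = refl

  lookup-consecutive : ∀ (y : V) ys z (i : Fin (ℕ.suc (length ys))) →
    Consecutive (lookup (y ∷ ys) i) (lookup (z ∷ ys) (nextFin i)) (y ∷ ys ++ [ z ])
  lookup-consecutive y []        z fzero    = here
  lookup-consecutive y (y′ ∷ ys) z fzero    = here
  lookup-consecutive y (y′ ∷ ys) z (fsuc i) =
    subst (λ w → Consecutive _ w _) (sym (lookup-next-suc z y′ ys i))
          (there (lookup-consecutive y′ ys z i))

  consecutive-lookup : ∀ {u v} (y : V) ys z → Consecutive u v (y ∷ ys ++ [ z ]) →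
    Σ (Fin (ℕ.suc (length ys))) λ i → lookup (y ∷ ys) i ≡ u × lookup (z ∷ ys) (nextFin i) ≡ v
  consecutive-lookup y []        z here               = fzero , refl , refl
  consecutive-lookup y []        z (there (there ()))
  consecutive-lookup y (y′ ∷ ys) z here               = fzero , refl , refl
  consecutive-lookup y (y′ ∷ ys) z (there p) with consecutive-lookup y′ ys z p
  ... | i , at-i , at-next = fsuc i , at-i , trans (lookup-next-suc z y′ ys i) at-next

  record ClosedTour : Set where
    field
      start    : V
      rest     : List V
      long     : 2 ≤ length rest
      distinct : Unique (start ∷ rest)
      covers   : ∀ v → v ∈ start ∷ rest
      linked   : Linked (Adj Γ) (start ∷ rest ++ [ start ])

    hamCycle : HamCycle Γ
    hamCycle = record
      { len   = length rest
      ; len≥2 = long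
      ; vtx   = lookup (start ∷ rest)
      ; inj   = lookup-injective distinct
      ; surj  = λ v → index (covers v) , sym (lookup-index (covers v))
      ; adj   = λ i → linked-consecutive linked (lookup-consecutive start rest start i)
      }

    consecutive⇒edge : ∀ {u v} →
      Consecutive u v (start ∷ rest ++ [ start ]) ⊎ Consecutive v u (start ∷ rest ++ [ start ]) →
      EdgeOfCycle hamCycle u v
    consecutive⇒edge (inj₁ p) with consecutive-lookup start rest start p
    ... | i , at-i , at-next = i , inj₁ (at-i , at-next)
    consecutive⇒edge (inj₂ p) with consecutive-lookup start rest start p
    ... | i , at-i , at-next = i , inj₂ (at-i , at-next)

last-or-inject₁ : ∀ {k} (i : Fin (ℕ.suc k)) → i ≡ fromℕ k ⊎ Σ (Fin k) λ j → i ≡ inject₁ j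
last-or-inject₁ {ℕ.zero}  fzero    = inj₁ refl
last-or-inject₁ {ℕ.suc k} fzero    = inj₂ (fzero , refl)
last-or-inject₁ {ℕ.suc k} (fsuc i) with last-or-inject₁ i
... | inj₁ e       = inj₁ (cong fsuc e)
... | inj₂ (j , e) = inj₂ (fsuc j , cong fsuc e)

nextFin-inject₁ : ∀ {k} (j : Fin k) → nextFin (inject₁ j) ≡ fsuc j
nextFin-inject₁ {ℕ.suc k} fzero    = refl
nextFin-inject₁ {ℕ.suc k} (fsuc j) rewrite nextFin-inject₁ j = refl

nextFin-last : ∀ k → nextFin (fromℕ k) ≡ fzero
nextFin-last ℕ.zero    = refl
nextFin-last (ℕ.suc k) rewrite nextFin-last k = refl

nextFin-injective : ∀ {k} (a b : Fin (ℕ.suc k)) → nextFin a ≡ nextFin b → a ≡ b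
nextFin-injective a b e with last-or-inject₁ a | last-or-inject₁ b
... | inj₁ refl       | inj₁ refl = refl
... | inj₁ refl       | inj₂ (j , refl) with trans (sym (nextFin-last _)) (trans e (nextFin-inject₁ j))
...   | ()
nextFin-injective a b e | inj₂ (i , refl) | inj₁ refl with trans (sym (nextFin-inject₁ i)) (trans e (nextFin-last _))
...   | ()
nextFin-injective a b e | inj₂ (i , refl) | inj₂ (j , refl) with trans (sym (nextFin-inject₁ i)) (trans e (nextFin-inject₁ j))
...   | refl = refl

predecessor : ∀ {k} (p : Fin (ℕ.suc k)) → Σ (Fin (ℕ.suc k)) λ i → nextFin i ≡ p
predecessor {k} fzero    = fromℕ k , nextFin-last k
predecessor     (fsuc q) = inject₁ q , nextFin-inject₁ q

toℕ-nextFin : ∀ {k} (i : Fin (ℕ.suc k)) →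
  (toℕ i ≡ k × nextFin i ≡ fzero) ⊎ toℕ (nextFin i) ≡ ℕ.suc (toℕ i)
toℕ-nextFin {k} i with last-or-inject₁ i
... | inj₁ refl = inj₁ (FinP.toℕ-fromℕ k , nextFin-last k)
... | inj₂ (j , refl) rewrite nextFin-inject₁ j = inj₂ (cong ℕ.suc (sym (FinP.toℕ-inject₁ j)))

open ≡-Reasoning

nextFin-no-fixpoint : ∀ {k} → 1 ≤ k → (i : Fin (ℕ.suc k)) → nextFin i ≢ i
nextFin-no-fixpoint {k} 1≤k i i′≡i with toℕ-nextFin i
... | inj₁ (i≡k , i′≡0) = ℕP.<⇒≢ 1≤k (begin
      0               ≡⟨ cong toℕ (sym i′≡0) ⟩
      toℕ (nextFin i) ≡⟨ cong toℕ i′≡i ⟩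
      toℕ i           ≡⟨ i≡k ⟩
      k               ∎)
... | inj₂ incr = ℕP.1+n≢n (sym (begin
      toℕ i           ≡⟨ cong toℕ (sym i′≡i) ⟩
      toℕ (nextFin i) ≡⟨ incr ⟩
      ℕ.suc (toℕ i)   ∎))

nextFin²-no-fixpoint : ∀ {k} → 2 ≤ k → (i : Fin (ℕ.suc k)) → nextFin (nextFin i) ≢ i
nextFin²-no-fixpoint {k} 2≤k i i″≡i with toℕ-nextFin i | toℕ-nextFin (nextFin i)
-- k ↦ 0 and 0 is the last position: k = 0
... | inj₁ (_ , i′≡0) | inj₁ (i′≡k , _) = ℕP.<⇒≢ (ℕP.≤-trans (s≤s z≤n) 2≤k) (sym (begin
      k                      ≡⟨ sym i′≡k ⟩
      toℕ (nextFin i)        ≡⟨ cong toℕ i′≡0 ⟩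
      0                      ∎))
-- k ↦ 0 ↦ 1 = k: k = 1
... | inj₁ (i≡k , i′≡0) | inj₂ incr = ℕP.<⇒≢ 2≤k (sym (begin
      k                         ≡⟨ sym i≡k ⟩
      toℕ i                     ≡⟨ cong toℕ (sym i″≡i) ⟩
      toℕ (nextFin (nextFin i)) ≡⟨ incr ⟩
      ℕ.suc (toℕ (nextFin i))   ≡⟨ cong (λ j → ℕ.suc (toℕ j)) i′≡0 ⟩
      1                         ∎))
-- i ↦ k ↦ 0 = i: k = 1
... | inj₂ incr | inj₁ (i′≡k , i″≡0) = ℕP.<⇒≢ 2≤k (sym (begin
      k                       ≡⟨ sym i′≡k ⟩
      toℕ (nextFin i)         ≡⟨ incr ⟩
      ℕ.suc (toℕ i)           ≡⟨ cong (λ j → ℕ.suc (toℕ j)) (trans (sym i″≡i) i″≡0) ⟩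
      1                       ∎))
-- i ↦ i + 1 ↦ i + 2 = i is impossible
... | inj₂ incr | inj₂ incr′ = ℕP.<-irrefl (begin
      toℕ i                          ≡⟨ cong toℕ (sym i″≡i) ⟩
      toℕ (nextFin (nextFin i))      ≡⟨ incr′ ⟩
      ℕ.suc (toℕ (nextFin i))        ≡⟨ cong ℕ.suc incr ⟩
      ℕ.suc (ℕ.suc (toℕ i))          ∎) (s≤s (ℕP.n≤1+n _))

tabulate-linked : ∀ {X : Set} (R : X → X → Set) m (g : Fin (ℕ.suc m) → X) z →
  (∀ j → R (g (inject₁ j)) (g (fsuc j))) → R (g (fromℕ m)) z → Linked R (tabulate g ++ [ z ])
tabulate-linked R ℕ.zero    g z steps close = close ∷ [-]
tabulate-linked R (ℕ.suc m) g z steps close =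
  steps fzero ∷ tabulate-linked R m (λ x → g (fsuc x)) z (λ j → steps (fsuc j)) close

allFin-linked : ∀ k → Linked (λ a b → nextFin a ≡ b) (allFin (ℕ.suc k) ++ [ fzero ])
allFin-linked k = tabulate-linked _ k (λ x → x) fzero nextFin-inject₁ (nextFin-last k)

module _ {X : Set} where

  remove : ∀ {y : X} ys → y ∈ ys → Σ (List X) λ ys′ →
    length ys ≡ ℕ.suc (length ys′) × (∀ {z} → z ∈ ys → z ≢ y → z ∈ ys′)
  remove (y ∷ ys) (here refl) = ys , refl , λ { (here refl) z≢y → ⊥-elim (z≢y refl) ; (there p) _ → p }
  remove (w ∷ ys) (there p) with remove ys p
  ... | ys′ , len , keep = w ∷ ys′ , cong ℕ.suc len , λ { (here refl) _ → here refl ; (there q) z≢y → there (keep q z≢y) }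

  distinct-members-length : ∀ (xs ys : List X) → Unique xs → All (_∈ ys) xs → length xs ≤ length ys
  distinct-members-length []       ys _           _        = z≤n
  distinct-members-length (x ∷ xs) ys (x∉ ∷ uxs) (x∈ ∷ xs∈) with remove ys x∈
  ... | ys′ , len , keep rewrite len = s≤s (distinct-members-length xs ys′ uxs (still-in x∉ xs∈))
    where
    still-in : ∀ {zs} → All (x ≢_) zs → All (_∈ ys) zs → All (_∈ ys′) zs
    still-in []          []          = []
    still-in (x≢z ∷ x≢s) (z∈ ∷ zs∈) = keep z∈ (λ z≡x → x≢z (sym z≡x)) ∷ still-in x≢s zs∈

module Edges {n} (G : FinGraph n) where

  E : Set
  E = Edge G

  _∋_ : E → Fin n → Set
  e ∋ x = x ≡ proj₁ (proj₁ e) ⊎ x ≡ proj₂ (proj₁ e)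

  _∋?_ : (e : E) (x : Fin n) → Dec (e ∋ x)
  e ∋? x = (x FinP.≟ proj₁ (proj₁ e)) ⊎-dec (x FinP.≟ proj₂ (proj₁ e))

  adjacency-irrelevant : ∀ {x y} (p q : adjᵇ G x y ≡ true) → p ≡ q
  adjacency-irrelevant = Decidable⇒UIP.≡-irrelevant Bool._≟_

  -- An edge is determined by its ordered pair of ends: the remaining
  -- components are proofs of propositions.
  edge-≡ : ∀ {e f : E} → proj₁ e ≡ proj₁ f → e ≡ f
  edge-≡ {p , lt , a} {.p , lt′ , a′} refl =
    cong₂ (λ x y → p , x , y) (FinP.<-irrelevant lt lt′) (adjacency-irrelevant a a′)

  _≟E_ : (e f : E) → Dec (e ≡ f)
  ((a , b) , _) ≟E ((c , d) , _) with a FinP.≟ c | b FinP.≟ d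
  ... | yes refl | yes refl = yes (edge-≡ refl)
  ... | no a≢c   | _        = no λ e → a≢c (cong (λ q → proj₁ (proj₁ q)) e)
  ... | _        | no b≢d   = no λ e → b≢d (cong (λ q → proj₂ (proj₁ q)) e)

  ends-of : ∀ {x y} (e : E) → x ≢ y → e ∋ x → e ∋ y →
    (proj₁ (proj₁ e) ≡ x × proj₂ (proj₁ e) ≡ y) ⊎ (proj₁ (proj₁ e) ≡ y × proj₂ (proj₁ e) ≡ x)
  ends-of e x≢y (inj₁ refl) (inj₁ refl) = ⊥-elim (x≢y refl)
  ends-of e x≢y (inj₁ refl) (inj₂ refl) = inj₁ (refl , refl)
  ends-of e x≢y (inj₂ refl) (inj₁ refl) = inj₂ (refl , refl)
  ends-of e x≢y (inj₂ refl) (inj₂ refl) = ⊥-elim (x≢y refl)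

  edge-ext : ∀ {x y} (e f : E) → x ≢ y → e ∋ x → e ∋ y → f ∋ x → f ∋ y → e ≡ f
  edge-ext e f x≢y ex ey fx fy with ends-of e x≢y ex ey | ends-of f x≢y fx fy
  ... | inj₁ (refl , refl) | inj₁ (e₁ , e₂) = edge-≡ (sym (cong₂ _,_ e₁ e₂))
  ... | inj₂ (refl , refl) | inj₂ (e₁ , e₂) = edge-≡ (sym (cong₂ _,_ e₁ e₂))
  edge-ext ((a , b) , lt , _) ((c , d) , lt′ , _) _ _ _ _ _ | inj₁ (refl , refl) | inj₂ (refl , refl) =
    ⊥-elim (FinP.<-asym lt lt′)
  edge-ext ((a , b) , lt , _) ((c , d) , lt′ , _) _ _ _ _ _ | inj₂ (refl , refl) | inj₁ (refl , refl) =
    ⊥-elim (FinP.<-asym lt lt′)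

  adjacent⇒distinct : ∀ x y → adjᵇ G x y ≡ true → x ≢ y
  adjacent⇒distinct x .x xy refl with trans (sym (irreflᵇ G x)) xy
  ... | ()

  edge : (x y : Fin n) → adjᵇ G x y ≡ true → E
  edge x y xy with FinP.<-cmp x y
  ... | tri< x<y _ _ = (x , y) , x<y , xy
  ... | tri≈ _ x≡y _ = ⊥-elim (adjacent⇒distinct x y xy x≡y)
  ... | tri> _ _ y<x = (y , x) , y<x , trans (symᵇ G y x) xy

  edge-ends : ∀ x y xy → edge x y xy ∋ x × edge x y xy ∋ y
  edge-ends x y xy with FinP.<-cmp x y
  ... | tri< _ _ _   = inj₁ refl , inj₂ refl
  ... | tri≈ _ x≡y _ = ⊥-elim (adjacent⇒distinct x y xy x≡y)
  ... | tri> _ _ _   = inj₂ refl , inj₁ refl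

  edge-ends⁻ : ∀ x y xy z → edge x y xy ∋ z → z ≡ x ⊎ z ≡ y
  edge-ends⁻ x y xy z z∈ with FinP.<-cmp x y | z∈
  ... | tri< _ _ _   | inj₁ e = inj₁ e
  ... | tri< _ _ _   | inj₂ e = inj₂ e
  ... | tri≈ _ x≡y _ | _      = ⊥-elim (adjacent⇒distinct x y xy x≡y)
  ... | tri> _ _ _   | inj₁ e = inj₂ e
  ... | tri> _ _ _   | inj₂ e = inj₁ e

  other-end : ∀ (e : E) x → e ∋ x → Σ (Fin n) λ y → adjᵇ G x y ≡ true × e ∋ y × x ≢ y
  other-end ((a , b) , _ , ab) .a (inj₁ refl) = b , ab , inj₂ refl , adjacent⇒distinct a b ab
  other-end ((a , b) , _ , ab) .b (inj₂ refl) =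
    a , trans (symᵇ G b a) ab , inj₁ refl , adjacent⇒distinct b a (trans (symᵇ G b a) ab)

  shareEnd⇒common : ∀ (e f : E) → ShareEnd {G = G} e f → Σ (Fin n) λ x → e ∋ x × f ∋ x
  shareEnd⇒common ((a , b) , _) ((c , d) , _) (inj₁ refl)                 = a , inj₁ refl , inj₁ refl
  shareEnd⇒common ((a , b) , _) ((c , d) , _) (inj₂ (inj₁ refl))          = a , inj₁ refl , inj₂ refl
  shareEnd⇒common ((a , b) , _) ((c , d) , _) (inj₂ (inj₂ (inj₁ refl)))   = b , inj₂ refl , inj₁ refl
  shareEnd⇒common ((a , b) , _) ((c , d) , _) (inj₂ (inj₂ (inj₂ refl)))   = b , inj₂ refl , inj₂ refl

  common⇒shareEnd : ∀ (e f : E) x → e ∋ x → f ∋ x → ShareEnd {G = G} e f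
  common⇒shareEnd e f x (inj₁ refl) (inj₁ refl) = inj₁ refl
  common⇒shareEnd e f x (inj₁ refl) (inj₂ refl) = inj₂ (inj₁ refl)
  common⇒shareEnd e f x (inj₂ refl) (inj₁ refl) = inj₂ (inj₂ (inj₁ refl))
  common⇒shareEnd e f x (inj₂ refl) (inj₂ refl) = inj₂ (inj₂ (inj₂ refl))

  distinct-neighbours : ∀ x (ys : List (Fin n)) → Unique ys → All (λ y → adjᵇ G x y ≡ true) ys →
    length ys ≤ degree G x
  distinct-neighbours x ys uys adj = distinct-members-length ys _ uys (All.map in-filter adj)
    where
    in-filter : ∀ {y} → adjᵇ G x y ≡ true → y ∈ filterᵇ (adjᵇ G x) (allFin n)
    in-filter {y} xy = ∈-filter⁺ (λ z → Bool.T? (adjᵇ G x z)) (∈-allFin y) (subst Bool.T (sym xy) _)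

-- The hamiltonian cycle of L(G) through a perfect matching M of L(G),
-- built from a hamiltonian cycle of G when Δ(G) ≤ 3.

module Tour {n} (G : FinGraph n) (H : HamCycle (toGraph G))
            (Δ≤3 : MaxDegreeAtMost G 3) (PM : PerfectMatching (LineGraph G)) where

  open Edges G
  open ClosedWalk (LineGraph G)

  k : ℕ
  k = len H

  Pos : Set
  Pos = Fin (ℕ.suc k)

  v : Pos → Fin n
  v = vtx H

  next : Pos → Pos
  next = nextFin

  1≤k : 1 ≤ k
  1≤k = ℕP.≤-trans (s≤s z≤n) (len≥2 H)

  v-next≢ : ∀ i → v (next i) ≢ v i
  v-next≢ i eq = nextFin-no-fixpoint 1≤k i (inj H _ _ eq)

  v-next²≢ : ∀ i → v (next (next i)) ≢ v i
  v-next²≢ i eq = nextFin²-no-fixpoint (len≥2 H) i (inj H _ _ eq)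

  cyc : Pos → E
  cyc i = edge (v i) (v (next i)) (adj H i)

  Chord : E → Set
  Chord e = ∀ m → e ≢ cyc m

  cycle-edge? : ∀ e → Dec (∃ λ m → e ≡ cyc m)
  cycle-edge? e = FinP.any? (λ m → e ≟E cyc m)

  cyc-start : ∀ i → cyc i ∋ v i
  cyc-start i = proj₁ (edge-ends _ _ (adj H i))

  cyc-end : ∀ i → cyc i ∋ v (next i)
  cyc-end i = proj₂ (edge-ends _ _ (adj H i))

  cyc-ends⁻ : ∀ m p → cyc m ∋ v p → m ≡ p ⊎ next m ≡ p
  cyc-ends⁻ m p m∋p with edge-ends⁻ _ _ (adj H m) _ m∋p
  ... | inj₁ e = inj₁ (inj H _ _ (sym e))
  ... | inj₂ e = inj₂ (inj H _ _ (sym e))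

  cyc-at : ∀ m j → cyc m ∋ v (next j) → m ≡ j ⊎ m ≡ next j
  cyc-at m j m∋ with cyc-ends⁻ m (next j) m∋
  ... | inj₁ m≡next = inj₂ m≡next
  ... | inj₂ next≡next = inj₁ (nextFin-injective m j next≡next)

  cyc-injective : ∀ {i j} → cyc i ≡ cyc j → i ≡ j
  cyc-injective {i} {j} eq
    with cyc-ends⁻ j i (subst (_∋ v i) eq (cyc-start i))
       | cyc-ends⁻ j (next i) (subst (_∋ v (next i)) eq (cyc-end i))
  ... | inj₁ j≡i   | _             = sym j≡i
  ... | inj₂ _     | inj₂ next≡next = sym (nextFin-injective j i next≡next)
  ... | inj₂ next≡i | inj₁ j≡next  =
    ⊥-elim (nextFin²-no-fixpoint (len≥2 H) i (trans (cong next (sym j≡next)) next≡i))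

  -- Every vertex is some vⱼ₊₁, so edges sharing an end share some vⱼ₊₁.
  common-end : ∀ e f → ShareEnd {G = G} e f → Σ Pos λ j → e ∋ v (next j) × f ∋ v (next j)
  common-end e f s with shareEnd⇒common e f s
  ... | x , e∋x , f∋x with surj H x
  ...   | p , refl with predecessor p
  ...     | j , refl = j , e∋x , f∋x

  meet : ∀ e f x → e ≢ f → e ∋ x → f ∋ x → Adj (LineGraph G) e f
  meet e f x e≢f e∋x f∋x = e≢f , common⇒shareEnd e f x e∋x f∋x

  mate : E → E
  mate e = proj₁ (unique PM e)

  mate-matched : ∀ e → M PM e (mate e)
  mate-matched e = proj₁ (proj₂ (unique PM e))

  same-mate : ∀ {e f g} → M PM e f → M PM e g → f ≡ g
  same-mate {e} {f} {g} ef eg = trans (proj₂ (proj₂ (unique PM e)) f ef) (sym (proj₂ (proj₂ (unique PM e)) g eg))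

  OffCycleAt : Pos → E → Set
  OffCycleAt j e = e ∋ v (next j) × e ≢ cyc j × e ≢ cyc (next j)

  offCycle-chord : ∀ {j e} → OffCycleAt j e → Chord e
  offCycle-chord {j} (e∋ , e≢j , e≢next) m refl with cyc-at m j e∋
  ... | inj₁ refl = e≢j refl
  ... | inj₂ refl = e≢next refl

  -- Δ(G) ≤ 3: each vertex meets at most one chord.
  offCycle-unique : ∀ {j e e′} → OffCycleAt j e → OffCycleAt j e′ → e ≡ e′
  offCycle-unique {j} {e} {e′} (e∋ , e≢j , e≢next) (e′∋ , e′≢j , e′≢next)
    with other-end e _ e∋ | other-end e′ _ e′∋
  ... | y , my , e∋y , m≢y | y′ , my′ , e′∋y′ , _ with y FinP.≟ y′
  ...   | yes refl = edge-ext e e′ m≢y e∋ e∋y e′∋ e′∋y′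
  ...   | no y≢y′  =
    ⊥-elim (ℕP.<-irrefl refl (ℕP.≤-trans (distinct-neighbours (v m) four four-distinct adjacent) (Δ≤3 (v m))))
    where
    m = next j
    four = v j ∷ v (next m) ∷ y ∷ y′ ∷ []
    avoids-prev : ∀ {f z} → f ∋ v m → f ≢ cyc j → f ∋ z → v j ≢ z
    avoids-prev {f} f∋ f≢ f∋z refl = f≢ (edge-ext f (cyc j) (v-next≢ j) f∋ f∋z (cyc-end j) (cyc-start j))
    avoids-next : ∀ {f z} → f ∋ v m → f ≢ cyc m → f ∋ z → v (next m) ≢ z
    avoids-next {f} f∋ f≢ f∋z refl =
      f≢ (edge-ext f (cyc m) (λ q → v-next≢ m (sym q)) f∋ f∋z (cyc-start m) (cyc-end m))
    four-distinct : Unique four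
    four-distinct = ((λ q → v-next²≢ j (sym q)) ∷ avoids-prev e∋ e≢j e∋y ∷ avoids-prev e′∋ e′≢j e′∋y′ ∷ [])
                  ∷ (avoids-next e∋ e≢next e∋y ∷ avoids-next e′∋ e′≢next e′∋y′ ∷ [])
                  ∷ (y≢y′ ∷ []) ∷ [] ∷ []
    adjacent : All (λ z → adjᵇ G (v m) z ≡ true) four
    adjacent = trans (symᵇ G (v m) (v j)) (adj H j) ∷ adj H m ∷ my ∷ my′ ∷ []

  -- Two chords sharing an end coincide; in particular they are not matched.
  chords-meeting : ∀ e f → Chord e → Chord f → ShareEnd {G = G} e f → e ≡ f
  chords-meeting e f e-chord f-chord s with common-end e f s
  ... | j , e∋ , f∋ = offCycle-unique (e∋ , e-chord j , e-chord (next j)) (f∋ , f-chord j , f-chord (next j))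

  AttachedAt : Pos → E → Set
  AttachedAt j h = OffCycleAt j h × (mate h ≡ cyc j ⊎ mate h ≡ cyc (next j))

  attached? : ∀ j h → Dec (AttachedAt j h)
  attached? j h = ((h ∋? v (next j)) ×-dec ¬? (h ≟E cyc j) ×-dec ¬? (h ≟E cyc (next j)))
                  ×-dec ((mate h ≟E cyc j) ⊎-dec (mate h ≟E cyc (next j)))

  -- Every chord is attached somewhere: its partner is not a chord, hence a
  -- cycle edge eⱼ or eⱼ₊₁ through a common end vⱼ₊₁.
  chord-attached : ∀ h → Chord h → ∃ λ j → AttachedAt j h
  chord-attached h chord with M⊆E PM (mate-matched h)
  ... | h≢mate , s with cycle-edge? (mate h)
  ...   | no mate-chord = ⊥-elim (h≢mate (chords-meeting h (mate h) chord (λ m q → mate-chord (m , q)) s))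
  ...   | yes (m , mate≡) with common-end h (mate h) s
  ...     | j , h∋ , mate∋ with cyc-at m j (subst (_∋ v (next j)) mate≡ mate∋)
  ...       | inj₁ refl = j , (h∋ , chord j , chord (next j)) , inj₁ mate≡
  ...       | inj₂ refl = j , (h∋ , chord j , chord (next j)) , inj₂ mate≡

  attached-once : ∀ {i j h} → AttachedAt i h → AttachedAt j h → i ≡ j
  attached-once ((h∋i , h≢i , _) , mi) ((h∋j , _ , _) , mj) with mi | mj
  ... | inj₁ a | inj₁ b = cyc-injective (trans (sym a) b)
  ... | inj₂ a | inj₂ b = nextFin-injective _ _ (cyc-injective (trans (sym a) b))
  ... | inj₁ a | inj₂ b with cyc-injective (trans (sym a) b)
  ...   | refl = ⊥-elim (h≢i (edge-ext _ _ (λ q → v-next≢ _ (sym q)) h∋j h∋i (cyc-start _) (cyc-end _)))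
  attached-once ((h∋i , _ , _) , _) ((h∋j , h≢j , _) , _) | inj₂ a | inj₁ b with cyc-injective (trans (sym b) a)
  ...   | refl = ⊥-elim (h≢j (edge-ext _ _ (λ q → v-next≢ _ (sym q)) h∋i h∋j (cyc-start _) (cyc-end _)))

  -- The chord attached at j can be searched for through its far end y.
  AttachedVia : Pos → Fin n → Set
  AttachedVia j y = Σ (adjᵇ G (v (next j)) y ≡ true) λ my → AttachedAt j (edge _ y my)

  attachedVia? : ∀ j y → Dec (AttachedVia j y)
  attachedVia? j y with adjᵇ G (v (next j)) y Bool.≟ true
  ... | no ¬my = no (λ a → ¬my (proj₁ a))
  ... | yes my with attached? j (edge _ y my)
  ...   | yes a = yes (my , a)
  ...   | no ¬a = no (λ (my′ , a) → ¬a (subst (λ p → AttachedAt j (edge _ y p)) (adjacency-irrelevant my′ my) a))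

  chordAt : Pos → Maybe E
  chordAt j with FinP.any? (attachedVia? j)
  ... | yes (y , my , _) = just (edge _ y my)
  ... | no _             = nothing

  data ChordAt (j : Pos) : Maybe E → Set where
    none : (∀ h → ¬ AttachedAt j h) → ChordAt j nothing
    some : ∀ {h} → AttachedAt j h → ChordAt j (just h)

  chordAt-spec : ∀ j → ChordAt j (chordAt j)
  chordAt-spec j with FinP.any? (attachedVia? j)
  ... | yes (y , my , a) = some a
  ... | no not-found     = none (λ h a → not-found (via h a))
    where
    via : ∀ h → AttachedAt j h → ∃ (AttachedVia j)
    via h a with other-end h _ (proj₁ (proj₁ a))
    ... | y , my , h∋y , m≢y =
      y , my , subst (AttachedAt j)
                     (edge-ext h _ m≢y (proj₁ (proj₁ a)) h∋y (proj₁ (edge-ends _ _ my)) (proj₂ (edge-ends _ _ my))) a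

  chordAt-attached : ∀ j {h} → chordAt j ≡ just h → AttachedAt j h
  chordAt-attached j eq with chordAt j | chordAt-spec j
  chordAt-attached j refl | just h | some a = a

  attached-chordAt : ∀ j {h} → AttachedAt j h → chordAt j ≡ just h
  attached-chordAt j {h} a with chordAt j | chordAt-spec j
  ... | nothing | none ¬a = ⊥-elim (¬a h a)
  ... | just h′ | some a′ = cong just (offCycle-unique (proj₁ a′) (proj₁ a))

  segment : Pos → List E
  segment j = cyc j ∷ fromMaybe (chordAt j)

  segment-members : ∀ j {x} → x ∈ segment j → x ≡ cyc j ⊎ chordAt j ≡ just x
  segment-members j (here x≡) = inj₁ x≡
  segment-members j (there x∈) with chordAt j
  segment-members j (there (here refl)) | just h = inj₂ refl

  segment-unique : ∀ j → Unique (segment j)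
  segment-unique j with chordAt j | chordAt-spec j
  ... | nothing | _      = [] ∷ []
  ... | just h  | some a = ((λ eq → offCycle-chord (proj₁ a) j (sym eq)) ∷ []) ∷ [] ∷ []

  segments-disjoint : ∀ {i j x} → x ∈ segment i → x ∈ segment j → i ≡ j
  segments-disjoint {i} {j} x∈i x∈j with segment-members i x∈i | segment-members j x∈j
  ... | inj₁ a | inj₁ b = cyc-injective (trans (sym a) b)
  ... | inj₁ a | inj₂ b = ⊥-elim (offCycle-chord (proj₁ (chordAt-attached j b)) i a)
  ... | inj₂ a | inj₁ b = ⊥-elim (offCycle-chord (proj₁ (chordAt-attached i a)) j b)
  ... | inj₂ a | inj₂ b = attached-once (chordAt-attached i a) (chordAt-attached j b)

  segment-linked : ∀ j → Linked (Adj (LineGraph G)) (segment j ++ [ cyc (next j) ])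
  segment-linked j with chordAt j | chordAt-spec j
  ... | nothing | _ =
    meet _ _ _ (λ q → nextFin-no-fixpoint 1≤k j (sym (cyc-injective q))) (cyc-end j) (cyc-start (next j)) ∷ [-]
  ... | just h  | some ((h∋ , h≢j , h≢next) , _) =
    meet _ _ _ (λ q → h≢j (sym q)) (cyc-end j) h∋ ∷ meet _ _ _ h≢next h∋ (cyc-start (next j)) ∷ [-]

  walk : List Pos → List E
  walk = concatMap segment

  walk-members : ∀ is {x} → x ∈ walk is → ∃ λ j → j ∈ is × x ∈ segment j
  walk-members (i ∷ is) x∈ with ∈-++⁻ (segment i) x∈
  ... | inj₁ x∈i  = i , here refl , x∈i
  ... | inj₂ x∈is with walk-members is x∈is
  ...   | j , j∈ , x∈j = j , there j∈ , x∈j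

  ∈-walk : ∀ {is j x} → j ∈ is → x ∈ segment j → x ∈ walk is
  ∈-walk {i ∷ is} (here refl) x∈ = ∈-++⁺ˡ x∈
  ∈-walk {i ∷ is} (there j∈)  x∈ = ∈-++⁺ʳ (segment i) (∈-walk j∈ x∈)

  walk-unique : ∀ is → Unique is → Unique (walk is)
  walk-unique []       _          = []
  walk-unique (i ∷ is) (i∉ ∷ uis) = UniqueP.++⁺ (segment-unique i) (walk-unique is uis) disjoint
    where
    disjoint : ∀ {x} → ¬ (x ∈ segment i × x ∈ walk is)
    disjoint (x∈i , x∈is) with walk-members is x∈is
    ... | j , j∈ , x∈j = All.lookup i∉ j∈ (segments-disjoint x∈i x∈j)

  walk-length : ∀ is → length is ≤ length (walk is)
  walk-length []       = z≤n
  walk-length (i ∷ is) = s≤s (ℕP.≤-trans (walk-length is) (ListP.length-++-≤ʳ (walk is) {fromMaybe (chordAt i)}))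

  _↦_ : Pos → Pos → Set
  a ↦ b = next a ≡ b

  walk-cons : ∀ i is z → walk (i ∷ is) ++ [ cyc z ] ≡ segment i ++ (walk is ++ [ cyc z ])
  walk-cons i is z = ListP.++-assoc (segment i) (walk is) [ cyc z ]

  walk-linked : ∀ i is z → Linked _↦_ (i ∷ is ++ [ z ]) → Linked (Adj (LineGraph G)) (walk (i ∷ is) ++ [ cyc z ])
  walk-linked i [] z (i↦z ∷ [-]) =
    subst (Linked _) (sym (walk-cons i [] z)) (subst (λ w → Linked _ (segment i ++ [ cyc w ])) i↦z (segment-linked i))
  walk-linked i (i′ ∷ is) z (i↦i′ ∷ l) =
    subst (Linked _) (sym (walk-cons i (i′ ∷ is) z))
      (linked-join (segment i) (subst (λ w → Linked _ (segment i ++ [ cyc w ])) i↦i′ (segment-linked i))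
                   (walk-linked i′ is z l))

  walk-consecutive : ∀ i is z → Linked _↦_ (i ∷ is ++ [ z ]) → ∀ {j u w} → j ∈ i ∷ is →
    Consecutive u w (segment j ++ [ cyc (next j) ]) → Consecutive u w (walk (i ∷ is) ++ [ cyc z ])
  walk-consecutive i [] z (i↦z ∷ [-]) (here refl) c =
    subst (Consecutive _ _) (sym (walk-cons i [] z)) (subst (λ w → Consecutive _ _ (segment i ++ [ cyc w ])) i↦z c)
  walk-consecutive i (i′ ∷ is) z (i↦i′ ∷ l) (here refl) c =
    subst (Consecutive _ _) (sym (walk-cons i (i′ ∷ is) z))
      (consecutive-++ˡ (segment i) (subst (λ w → Consecutive _ _ (segment i ++ [ cyc w ])) i↦i′ c))
  walk-consecutive i (i′ ∷ is) z (_ ∷ l) (there j∈) c =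
    subst (Consecutive _ _) (sym (walk-cons i (i′ ∷ is) z))
      (consecutive-++ʳ (segment i) (walk-consecutive i′ is z l j∈ c))

  -- The tour e₀ [h₀] e₁ [h₁] … e_k [h_k], written as e₀ ∷ tourRest.
  positions : List Pos
  positions = drop 1 (allFin (ℕ.suc k))

  tour : List E
  tour = walk (fzero ∷ positions)

  tourRest : List E
  tourRest = drop 1 tour

  tour-complete : ∀ e → e ∈ tour
  tour-complete e with cycle-edge? e
  ... | yes (m , refl) = ∈-walk (∈-allFin m) (here refl)
  ... | no not-cycle with chord-attached e (λ m q → not-cycle (m , q))
  ...   | j , a = ∈-walk (∈-allFin j) (there (subst (λ c → e ∈ fromMaybe c) (sym (attached-chordAt j a)) (here refl)))

  tour-long : 2 ≤ length tourRest
  tour-long = ℕP.≤-trans (len≥2 H) (ℕP.≤-pred (ℕP.≤-trans (ℕP.≤-reflexive (sym (ListP.length-tabulate (λ x → x))))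
                                                           (walk-length (allFin (ℕ.suc k)))))

  lineTour : ClosedTour
  lineTour = record
    { start    = cyc fzero
    ; rest     = tourRest
    ; long     = tour-long
    ; distinct = walk-unique (allFin (ℕ.suc k)) (UniqueP.allFin⁺ (ℕ.suc k))
    ; covers   = tour-complete
    ; linked   = walk-linked fzero positions fzero (allFin-linked k)
    }

  in-tour : ∀ j {u w} → Consecutive u w (segment j ++ [ cyc (next j) ]) → Consecutive u w (tour ++ [ cyc fzero ])
  in-tour j = walk-consecutive fzero positions fzero (allFin-linked k) (∈-allFin j)

  -- M-matched cycle edges eⱼ, eⱼ₊₁ have no chord between them: it would be
  -- matched to one of them too.
  matched-cycle-edges : ∀ j → M PM (cyc j) (cyc (next j)) →
    Consecutive (cyc j) (cyc (next j)) (segment j ++ [ cyc (next j) ])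
  matched-cycle-edges j m with chordAt j | chordAt-spec j
  ... | nothing | _ = here
  ... | just h  | some ((_ , _ , h≢next) , inj₁ mate≡) =
    ⊥-elim (h≢next (same-mate (subst (λ c → M PM c h) mate≡ (M-sym PM (mate-matched h))) m))
  ... | just h  | some ((_ , h≢j , _) , inj₂ mate≡) =
    ⊥-elim (h≢j (same-mate (subst (λ c → M PM c h) mate≡ (M-sym PM (mate-matched h))) (M-sym PM m)))

  chord-consecutive : ∀ j {h} → chordAt j ≡ just h →
    Consecutive (cyc j) h (segment j ++ [ cyc (next j) ]) × Consecutive h (cyc (next j)) (segment j ++ [ cyc (next j) ])
  chord-consecutive j eq rewrite eq = here , there here

  Closed : E → E → Set
  Closed u w = Consecutive u w (tour ++ [ cyc fzero ]) ⊎ Consecutive w u (tour ++ [ cyc fzero ])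

  -- An M-edge between cycle edges eₐ, e_b: they meet at some vⱼ₊₁, so
  -- {a, b} = {j, j+1}.
  matched-cycle-pair : ∀ a b → M PM (cyc a) (cyc b) → Closed (cyc a) (cyc b)
  matched-cycle-pair a b m with M⊆E PM m
  ... | a≢b , s with common-end (cyc a) (cyc b) s
  ...   | j , a∋ , b∋ with cyc-at a j a∋ | cyc-at b j b∋
  ...     | inj₁ refl | inj₁ refl = ⊥-elim (a≢b refl)
  ...     | inj₂ refl | inj₂ refl = ⊥-elim (a≢b refl)
  ...     | inj₁ refl | inj₂ refl = inj₁ (in-tour j (matched-cycle-edges j m))
  ...     | inj₂ refl | inj₁ refl = inj₂ (in-tour j (matched-cycle-edges j (M-sym PM m)))

  -- An M-edge between eₐ and a chord h: h is attached at a or at a−1.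
  matched-chord : ∀ a h → Chord h → M PM (cyc a) h → Closed (cyc a) h
  matched-chord a h chord m with chord-attached h chord
  ... | j , a-att with proj₂ a-att | same-mate (M-sym PM m) (mate-matched h)
  ...   | inj₁ mate≡ | a≡mate with cyc-injective (trans a≡mate mate≡)
  ...     | refl = inj₁ (in-tour j (proj₁ (chord-consecutive j (attached-chordAt j a-att))))
  matched-chord a h chord m | j , a-att | inj₂ mate≡ | a≡mate with cyc-injective (trans a≡mate mate≡)
  ...     | refl = inj₂ (in-tour j (proj₂ (chord-consecutive j (attached-chordAt j a-att))))

  swap-closed : ∀ {u w} → Closed u w → Closed w u
  swap-closed (inj₁ c) = inj₂ c
  swap-closed (inj₂ c) = inj₁ c

  matching-closed : ∀ u w → M PM u w → Closed u w
  matching-closed u w m with cycle-edge? u | cycle-edge? w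
  ... | yes (a , refl) | yes (b , refl) = matched-cycle-pair a b m
  ... | yes (a , refl) | no w-cyc       = matched-chord a w (λ b q → w-cyc (b , q)) m
  ... | no u-cyc       | yes (b , refl) = swap-closed (matched-chord b u (λ a q → u-cyc (a , q)) (M-sym PM m))
  ... | no u-cyc       | no w-cyc       =
    ⊥-elim (proj₁ (M⊆E PM m) (chords-meeting u w (λ a q → u-cyc (a , q)) (λ b q → w-cyc (b , q)) (proj₂ (M⊆E PM m))))

  hamCycle : HamCycle (LineGraph G)
  hamCycle = ClosedTour.hamCycle lineTour

  extends-matching : ∀ u w → M PM u w → EdgeOfCycle hamCycle u w
  extends-matching u w m = ClosedTour.consecutive⇒edge lineTour (matching-closed u w m)

-- Connectivity and n ≥ 3 are implied by the hamiltonian cycle and not needed.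
theorem2 : (n : ℕ) (G : FinGraph n) → 3 ≤ n → Connected (toGraph G) →
    Hamiltonian (toGraph G) → MaxDegreeAtMost G 3 → PMH (LineGraph G)
theorem2 _ G _ _ H Δ≤3 PM = Tour.hamCycle G H Δ≤3 PM , Tour.extends-matching G H Δ≤3 PM
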